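{- Let $a_n$ be the number of complete rulers of length $n$, i.e. the number of subsets $R\subseteq\{0,\dots,n\}$ with $\{0,\dots,n\}\subseteq R-R$, and let $\ell(0) := \lim_{n\to\infty} P(|S-S| = 2n-1)$ for $S$ a uniformly random subset of $[n]=\{0,\dots,n-1\}$ (this limit exists). Then $a_{n-1} \sim \ell(0)\cdot 2^n$ as $n\to\infty$, i.e. $a_{n-1}/2^n \to \ell(0)$.
   Context: For a positive integer $n$, $[n] := \{0,1,\dots,n-1\}$, random subsets are uniform over all $2^n$ subsets, and $R-R := \{x-y : x,y\in R\}$. A ruler of length $L$ is any subset of $\{0,\dots,L\}$; it is complete if it contains, in its difference set, every element of $\{0,\dots,L\}$. -}

module Defs where

open import Data.Bool using (Bool)
open import Data.Nat using (ℕ; zero; suc; _+_; _*_; _∸_; _^_)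
open import Data.Nat.Properties using (m^n≢0)
open import Data.Integer as ℤ using (ℤ; +_; -[1+_])
import Data.Integer.Properties as ℤP
open import Data.Fin using (Fin; toℕ)
open import Data.Fin.Subset using (Subset; _∈_)
open import Data.Fin.Subset.Properties using (_∈?_)
open import Data.Fin.Properties using (any?; all?)
open import Data.List using (List; []; _∷_; _++_; map; filter; length; upTo)
open import Data.Vec using ([]; _∷_)
open import Data.Product using (Σ; ∃; _×_; _,_)
open import Relation.Nullary using (Dec; yes; no)
open import Relation.Nullary.Decidable using (_×-dec_)
open import Relation.Binary.PropositionalEquality using (_≡_)
open import Data.Rational using (ℚ; _/_)

allSubsets : (n : ℕ) → List (Subset n)
allSubsets zero    = [] ∷ []
allSubsets (suc n) = map (Bool.true ∷_) (allSubsets n) ++ map (Bool.false ∷_) (allSubsets n)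
  where open import Data.Bool as Bool using ()

InDiff : {n : ℕ} → Subset n → ℤ → Set
InDiff {n} R d = Σ (Fin n) λ x → Σ (Fin n) λ y →
  (x ∈ R) × (y ∈ R) × ((+ toℕ x) ℤ.- (+ toℕ y) ≡ d)

inDiff? : {n : ℕ} → (R : Subset n) → (d : ℤ) → Dec (InDiff R d)
inDiff? R d = any? λ x → any? λ y →
  (x ∈? R) ×-dec ((y ∈? R) ×-dec ((+ toℕ x) ℤ.- (+ toℕ y) ℤP.≟ d))

-- A ruler of length L is a subset of {0,…,L} = Fin (suc L); it is complete
-- if every element of {0,…,L} lies in its difference set.
Complete : (L : ℕ) → Subset (suc L) → Set
Complete L R = (d : Fin (suc L)) → InDiff R (+ toℕ d)

complete? : (L : ℕ) → (R : Subset (suc L)) → Dec (Complete L R)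
complete? L R = all? λ d → inDiff? R (+ toℕ d)

a : ℕ → ℕ
a L = length (filter (complete? L) (allSubsets (suc L)))

-- The integers -n, …, n (every element of S - S, S ⊆ [n], lies here).
intRange : ℕ → List ℤ
intRange n = map (λ k → (+ k) ℤ.- (+ n)) (upTo (suc (n + n)))

diffCard : {n : ℕ} → Subset n → ℕ
diffCard {n} S = length (filter (inDiff? S) (intRange n))

b : ℕ → ℕ
b n = length (filter (λ S → diffCard S Data.Nat.≟ (2 * n ∸ 1)) (allSubsets n))
  where import Data.Nat

p : ℕ → ℚ
p n = (+ b n) / (2 ^ n) where instance _ = m^n≢0 2 n

-- x n = a_{n-1} / 2^n, reindexed: x n = a_n / 2^(n+1)
x : ℕ → ℚ
x n = (+ a n) / (2 ^ suc n) where instance _ = m^n≢0 2 (suc n)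

{-# OPTIONS --safe #-}
-- For S ⊆ {0, …, L} the difference set S − S is closed under negation and lies in
-- {−L, …, L}, which has 2(L + 1) − 1 elements.  So |S − S| = 2(L + 1) − 1 exactly when
-- {0, …, L} ⊆ S − S, i.e. when S is a complete ruler of length L.  Hence b (L + 1) = a L,
-- so x n = p (n + 1), and x n − p m → 0 because p is Cauchy.
module Submission where

open import Defs
open import Data.Nat using (ℕ; _≥_)
open import Data.Product using (Σ)
open import Data.Rational using (ℚ; 0ℚ; _<_; _-_; ∣_∣)

open import Data.Rational using (_/_)
open import Data.Nat as ℕ using (suc; _+_; _*_; _∸_; _^_; _≤_; _⊔_; s≤s; s≤s⁻¹)
import Data.Nat.Properties as ℕP
open import Data.Integer as ℤ using (ℤ; +_; -[1+_]; _⊖_)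
import Data.Integer.Properties as ℤP
open import Data.Fin using (toℕ; fromℕ<)
open import Data.Fin.Properties using (toℕ<n; toℕ-fromℕ<)
open import Data.Fin.Subset using (Subset)
open import Data.List using ([]; _∷_; [_]; _++_; _∷ʳ_; filter; length; map; upTo; applyUpTo)
import Data.List.Properties as LP
open import Data.List.Membership.Propositional using (_∈_)
open import Data.List.Membership.Propositional.Properties using (∈-map⁺; ∈-map⁻; ∈-upTo⁺; ∈-upTo⁻)
open import Data.List.Relation.Unary.All as All using (All)
open import Data.List.Relation.Unary.All.Properties using (all-filter)
open import Data.Product using (_,_)
open import Data.Sum using (inj₁; inj₂)
open import Function using (_∘_; _⇔_; mk⇔; Equivalence)
open import Relation.Nullary using (¬_)
open import Relation.Unary using (Pred; Decidable)
open import Relation.Binary.PropositionalEquality using (_≡_; refl; sym; trans; cong; cong₂; subst; module ≡-Reasoning)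

open Equivalence using (to; from)

module _ {a ℓ} {A : Set a} {P : Pred A ℓ} (P? : Decidable P) where

  length-filter≡length⇔All : ∀ xs → length (filter P? xs) ≡ length xs ⇔ All P xs
  length-filter≡length⇔All xs = mk⇔
    (λ eq → subst (All P) (LP.filter-complete P? eq) (all-filter P? xs))
    (λ Pxs → cong length (LP.filter-all P? Pxs))

InDiff-neg : ∀ {n} {R : Subset n} {d} → InDiff R d → InDiff R (ℤ.- d)
InDiff-neg (i , j , i∈R , j∈R , refl) = j , i , j∈R , i∈R , (begin
  + toℕ j ℤ.- + toℕ i        ≡⟨ ℤP.[+m]-[+n]≡m⊖n (toℕ j) (toℕ i) ⟩
  toℕ j ⊖ toℕ i              ≡⟨ ℤP.⊖-swap (toℕ j) (toℕ i) ⟩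
  ℤ.- (toℕ i ⊖ toℕ j)        ≡⟨ cong ℤ.-_ (ℤP.[+m]-[+n]≡m⊖n (toℕ i) (toℕ j)) ⟨
  ℤ.- (+ toℕ i ℤ.- + toℕ j)  ∎)
  where open ≡-Reasoning

InDiff⇒∣d∣≤ : ∀ {L} {R : Subset (suc L)} {d} → InDiff R d → ℤ.∣ d ∣ ≤ L
InDiff⇒∣d∣≤ {L} (i , j , _ , _ , refl) = begin
  ℤ.∣ + toℕ i ℤ.- + toℕ j ∣  ≡⟨ cong ℤ.∣_∣ (ℤP.[+m]-[+n]≡m⊖n (toℕ i) (toℕ j)) ⟩
  ℤ.∣ toℕ i ⊖ toℕ j ∣        ≤⟨ ℤP.∣m⊝n∣≤m⊔n (toℕ i) (toℕ j) ⟩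
  toℕ i ⊔ toℕ j              ≤⟨ ℕP.⊔-lub (s≤s⁻¹ (toℕ<n i)) (s≤s⁻¹ (toℕ<n j)) ⟩
  L                          ∎
  where open ℕP.≤-Reasoning

Complete⇒InDiff : ∀ {L} {R : Subset (suc L)} → Complete L R → ∀ {d} → ℤ.∣ d ∣ ≤ L → InDiff R d
Complete⇒InDiff c {+ k} k≤L =
  subst (InDiff _) (cong +_ (toℕ-fromℕ< (s≤s k≤L))) (c (fromℕ< (s≤s k≤L)))
Complete⇒InDiff c { -[1+ k ]} k<L = InDiff-neg (Complete⇒InDiff c {+ suc k} k<L)

offset : ℕ → ℕ → ℤ
offset L k = + k ℤ.- + L

offset-suc : ∀ L k → offset (suc L) (suc k) ≡ offset L k
offset-suc L k = begin
  suc k ⊖ suc L  ≡⟨ ℤP.[1+m]⊖[1+n]≡m⊖n k L ⟩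
  k ⊖ L          ≡⟨ ℤP.[+m]-[+n]≡m⊖n k L ⟨
  offset L k     ∎
  where open ≡-Reasoning

offset-+ : ∀ L t → offset L (t + L) ≡ + t
offset-+ L t = begin
  offset L (t + L)   ≡⟨ ℤP.[+m]-[+n]≡m⊖n (t + L) L ⟩
  (t + L) ⊖ L        ≡⟨ ℤP.⊖-≥ (ℕP.m≤n+m L t) ⟩
  + (t + L ∸ L)      ≡⟨ cong +_ (ℕP.m+n∸n≡m t L) ⟩
  + t                ∎
  where open ≡-Reasoning

∣offset∣≤ : ∀ {L k} → k ≤ L + L → ℤ.∣ offset L k ∣ ≤ L
∣offset∣≤ {L} {k} k≤2L
  rewrite ℤP.[+m]-[+n]≡m⊖n k L with ℕP.≤-total k L
... | inj₁ k≤L = subst (_≤ L) (sym (ℤP.∣⊖∣-≤ k≤L)) (ℕP.m∸n≤m L k)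
... | inj₂ L≤k = subst (_≤ L) (sym (cong ℤ.∣_∣ (ℤP.⊖-≥ L≤k))) (ℕP.m≤n+o⇒m∸n≤o k L k≤2L)

∈-intRange⁻ : ∀ {L d} → d ∈ intRange L → ℤ.∣ d ∣ ≤ L
∈-intRange⁻ {L} d∈ with ∈-map⁻ (offset L) d∈
... | k , k∈ , refl = ∣offset∣≤ (s≤s⁻¹ (∈-upTo⁻ k∈))

+∈intRange : ∀ {L t} → t ≤ L → + t ∈ intRange L
+∈intRange {L} {t} t≤L = subst (_∈ intRange L) (offset-+ L t)
  (∈-map⁺ (offset L) (∈-upTo⁺ (s≤s (ℕP.+-monoˡ-≤ L t≤L))))

intRange-suc : ∀ L → intRange (suc L) ≡ -[1+ L ] ∷ intRange L ∷ʳ + suc L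
intRange-suc L = begin
  map (offset (suc L)) (upTo (suc (suc L + suc L)))
    ≡⟨ LP.map-upTo (offset (suc L)) (suc (suc L + suc L)) ⟩
  -[1+ L ] ∷ applyUpTo inner (suc L + suc L)
    ≡⟨ cong (λ m → -[1+ L ] ∷ applyUpTo inner (suc m)) (ℕP.+-suc L L) ⟩
  -[1+ L ] ∷ applyUpTo inner (suc (suc (L + L)))
    ≡⟨ cong (-[1+ L ] ∷_) (LP.applyUpTo-∷ʳ inner (suc (L + L))) ⟨
  -[1+ L ] ∷ applyUpTo inner (suc (L + L)) ∷ʳ inner (suc (L + L))
    ≡⟨ cong₂ (λ xs y → -[1+ L ] ∷ xs ∷ʳ y) middle (trans (offset-suc L _) (offset-+ L (suc L))) ⟩
  -[1+ L ] ∷ intRange L ∷ʳ + suc L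
    ∎
  where
  open ≡-Reasoning
  inner : ℕ → ℤ
  inner = offset (suc L) ∘ suc
  middle : applyUpTo inner (suc (L + L)) ≡ intRange L
  middle = trans (sym (LP.map-upTo inner _)) (LP.map-cong (offset-suc L) _)

length-intRange : ∀ L → length (intRange L) ≡ 2 * suc L ∸ 1
length-intRange L = begin
  length (map (offset L) (upTo (suc (L + L))))  ≡⟨ LP.length-map (offset L) (upTo (suc (L + L))) ⟩
  length (upTo (suc (L + L)))                   ≡⟨ LP.length-upTo (suc (L + L)) ⟩
  suc (L + L)                                   ≡⟨ ℕP.+-suc L L ⟨
  L + suc L                                     ≡⟨ cong (λ m → L + suc m) (ℕP.+-identityʳ L) ⟨
  2 * suc L ∸ 1                                 ∎
  where open ≡-Reasoning

diffCard-suc : ∀ {L} (S : Subset (suc L)) → diffCard S ≡ length (filter (inDiff? S) (intRange L))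
diffCard-suc {L} S = cong length (begin
  filter P? (intRange (suc L))                     ≡⟨ cong (filter P?) (intRange-suc L) ⟩
  filter P? (-[1+ L ] ∷ intRange L ∷ʳ + suc L)     ≡⟨ LP.filter-reject P? (tooLarge refl) ⟩
  filter P? (intRange L ++ [ + suc L ])            ≡⟨ LP.filter-++ P? (intRange L) _ ⟩
  filter P? (intRange L) ++ filter P? [ + suc L ]
    ≡⟨ cong (filter P? (intRange L) ++_) (LP.filter-reject P? (tooLarge refl)) ⟩
  filter P? (intRange L) ++ []                     ≡⟨ LP.++-identityʳ _ ⟩
  filter P? (intRange L)                           ∎)
  where
  open ≡-Reasoning
  P? : Decidable (InDiff S)
  P? = inDiff? S
  tooLarge : ∀ {d} → ℤ.∣ d ∣ ≡ suc L → ¬ InDiff S d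
  tooLarge ∣d∣≡1+L d∈ = ℕP.n≮n L (subst (_≤ L) ∣d∣≡1+L (InDiff⇒∣d∣≤ d∈))

Complete⇔All-InDiff : ∀ L (R : Subset (suc L)) → Complete L R ⇔ All (InDiff R) (intRange L)
Complete⇔All-InDiff L R = mk⇔
  (λ c → All.tabulate (λ d∈ → Complete⇒InDiff c (∈-intRange⁻ d∈)))
  (λ all d → All.lookup all (+∈intRange (s≤s⁻¹ (toℕ<n d))))

maximalDiffCard⇔Complete : ∀ L (S : Subset (suc L)) → diffCard S ≡ 2 * suc L ∸ 1 ⇔ Complete L S
maximalDiffCard⇔Complete L S = mk⇔
  (λ eq → from allInDiff (to countMaximal (trans (sym (diffCard-suc S)) (trans eq (sym (length-intRange L))))))
  (λ c → trans (diffCard-suc S) (trans (from countMaximal (to allInDiff c)) (length-intRange L)))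
  where
  allInDiff : Complete L S ⇔ All (InDiff S) (intRange L)
  allInDiff = Complete⇔All-InDiff L S
  countMaximal : length (filter (inDiff? S) (intRange L)) ≡ length (intRange L) ⇔ All (InDiff S) (intRange L)
  countMaximal = length-filter≡length⇔All (inDiff? S) (intRange L)

b-suc≡a : ∀ L → b (suc L) ≡ a L
b-suc≡a L = cong length (LP.filter-≐ (λ S → diffCard S ℕ.≟ (2 * suc L ∸ 1)) (complete? L)
  ((λ {S} → to (maximalDiffCard⇔Complete L S)) , (λ {S} → from (maximalDiffCard⇔Complete L S)))
  (allSubsets (suc L)))

x≡p-suc : ∀ n → x n ≡ p (suc n)
x≡p-suc n = cong (λ k → _/_ (+ k) (2 ^ suc n) {{ℕP.m^n≢0 2 (suc n)}}) (sym (b-suc≡a n))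

lemma3p25 : ((ε : ℚ) → 0ℚ < ε → Σ ℕ λ N → (m n : ℕ) → m ≥ N → n ≥ N → ∣ p m - p n ∣ < ε)
    → (ε : ℚ) → 0ℚ < ε → Σ ℕ λ N → (m n : ℕ) → m ≥ N → n ≥ N → ∣ x n - p m ∣ < ε
lemma3p25 cauchy ε ε>0 = N , λ m n m≥N n≥N →
  subst (λ q → ∣ q - p m ∣ < ε) (sym (x≡p-suc n)) (close (suc n) m (ℕP.m≤n⇒m≤1+n n≥N) m≥N)
  where open Σ (cauchy ε ε>0) renaming (proj₁ to N; proj₂ to close)
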